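{- Let $G$ be a signed digraph with $n$ vertices and no negative cycles, and let $f$ be a Boolean network on $G$. The following are equivalent: (1) $f$ has a unique fixed point; (2) $f$ has a synchronizing word of length $n$; (3) $f$ is synchronizing.
   Context: A signed digraph on $V$ is a pair $(V,E)$ with $E\subseteq V\times V\times\{ -1,1\}$; $(j,i,s)\in E$ is an arc from $j$ to $i$ of sign $s$. Cycles are subgraphs without repeated vertices (loops included); the sign of a cycle is the product of its arc signs. A Boolean network (BN) with component set $V$ is a map $f:\{0,1\}^V\to\{0,1\}^V$; its signed interaction digraph has a positive (resp. negative) arc from $j$ to $i$ iff some $x$ with $x_j=0$ has $f_i(x+e_j)-f_i(x)>0$ (resp. $<0$), $x+e_j$ being $x$ with component $j$ flipped; a BN on $G$ has signed interaction digraph $G$. A fixed point is $x$ with $f(x)=x$. $f^i(x)$ equals $x$ except its $i$-th component is $f_i(x)$; $f^w=f^{i_\ell}\circ\cdots\circ f^{i_1}$ for $w=i_1\dots i_\ell$; $w$ is a synchronizing word for $f$ if $f^w$ is constant; $f$ is synchronizing if it has one. -}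

module Defs where

open import Data.Nat using (ℕ; zero; suc; _<_; _<?_)
open import Data.Bool using (Bool; true; false; not)
open import Data.Fin using (Fin; zero; suc; toℕ; fromℕ<)
open import Data.Vec using (Vec; lookup; updateAt; _[_]≔_)
open import Data.List using (List; []; _∷_; foldl; length)
open import Data.Product using (Σ; ∃; _×_; _,_)
open import Function.Definitions using (Injective)
open import Relation.Binary.PropositionalEquality using (_≡_)
open import Relation.Nullary using (yes; no; ¬_)

-- Configurations x ∈ {0,1}^V with V = Fin n (false = 0, true = 1)
Config : ℕ → Set
Config n = Vec Bool n

BN : ℕ → Set
BN n = Config n → Config n

flipAt : ∀ {n} → Config n → Fin n → Config n
flipAt x j = updateAt x j not

data Sign : Set where
  pos neg : Sign

_·_ : Sign → Sign → Sign
pos · s = s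
neg · pos = neg
neg · neg = pos

Arc : ∀ {n} → BN n → Fin n → Fin n → Sign → Set
Arc {n} f j i pos = ∃ λ (x : Config n) →
  lookup x j ≡ false × lookup (f x) i ≡ false × lookup (f (flipAt x j)) i ≡ true
Arc {n} f j i neg = ∃ λ (x : Config n) →
  lookup x j ≡ false × lookup (f x) i ≡ true × lookup (f (flipAt x j)) i ≡ false

next : ∀ {k} → Fin (suc k) → Fin (suc k)
next {k} m with suc (toℕ m) <? suc k
... | yes p = fromℕ< p
... | no _ = zero

prodSign : ∀ {k} → (Fin k → Sign) → Sign
prodSign {zero} s = pos
prodSign {suc k} s = s zero · prodSign (λ m → s (suc m))

-- A cycle of length suc k in the interaction digraph of f:
-- pairwise distinct vertices v 0, …, v k and, for each m, an arc
-- v m → v (m+1 mod (k+1)) of sign s m (k = 0 gives loops).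
record Cycle {n} (f : BN n) : Set where
  field
    k     : ℕ
    v     : Fin (suc k) → Fin n
    v-inj : Injective _≡_ _≡_ v
    s     : Fin (suc k) → Sign
    arcs  : ∀ m → Arc f (v m) (v (next m)) (s m)

NegativeCycle : ∀ {n} → BN n → Set
NegativeCycle f = Σ (Cycle f) λ C → prodSign (Cycle.s C) ≡ neg

NoNegativeCycle : ∀ {n} → BN n → Set
NoNegativeCycle f = ¬ NegativeCycle f

updComp : ∀ {n} → BN n → Fin n → Config n → Config n
updComp f i x = x [ i ]≔ lookup (f x) i

-- f^w = f^{i_ℓ} ∘ … ∘ f^{i_1} for w = i_1 … i_ℓ
updWord : ∀ {n} → BN n → List (Fin n) → Config n → Config n
updWord f w x = foldl (λ y i → updComp f i y) x w

IsFixedPoint : ∀ {n} → BN n → Config n → Set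
IsFixedPoint f x = f x ≡ x

UniqueFixedPoint : ∀ {n} → BN n → Set
UniqueFixedPoint f = ∃ λ x → IsFixedPoint f x × (∀ y → IsFixedPoint f y → y ≡ x)

IsSynchronizingWord : ∀ {n} → BN n → List (Fin n) → Set
IsSynchronizingWord f w = ∀ x y → updWord f w x ≡ updWord f w y

Synchronizing : ∀ {n} → BN n → Set
Synchronizing f = ∃ λ w → IsSynchronizingWord f w

module Submission where

-- A network g is confined to R when the components outside R are constant and influence
-- nothing; we induct on |R|. If some u ∈ R is constant, freeze it: fixed points of g and of
-- the frozen network coincide, and updating u first followed by a word for the frozen
-- network on R ∖ {u} synchronizes g. Otherwise R, being closed under predecessors, contains
-- a strongly connected set T closed under predecessors (the ancestors of a vertex with fewest
-- ancestors). Without negative cycles T has a balanced sign labelling σ, and the configurations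
-- σ and −σ on T span trap spaces: a non-constant component of T depends only on T, and
-- balance forces it to its label. Freezing T at either labelling and recursing gives two
-- fixed points that differ on T, so the fixed point is not unique there and only existence
-- is needed. Conversely, every update preserves fixed points, so a synchronizing word
-- leaves room for at most one.

open import Defs
open import Data.Nat using (ℕ; zero; suc; _<_; _≤_; _+_; z≤n; s≤s; _<?_)
open import Data.Nat.Properties
  using (≤-reflexive; ≤-trans; <⇒≱; ≤-refl; n≤1+n; ≤-totalOrder; ≤-antisym; ≮⇒≥; m≤n+m; m<m+n; m<n+m; +-monoʳ-<)
open import Data.Nat.Induction using (<-rec)
open import Data.Bool using (Bool; true; false; not; if_then_else_; _∨_; _∧_; _xor_)
open import Data.Bool.Properties
  using (¬-not; not-¬; not-involutive; ∨-zeroʳ; ∧-identityʳ; ∧-zeroʳ) renaming (_≟_ to _≟ᵇ_)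
open import Data.Fin using (Fin; zero; suc; toℕ; fromℕ; inject₁) renaming (_≟_ to _≟ᶠ_)
open import Data.Fin.Properties
  using (any?; suc-injective; toℕ-injective; toℕ<n; toℕ-fromℕ; toℕ-fromℕ<; toℕ-inject₁)
open import Data.Fin.Subset.Properties using (anySubset?)
open import Data.Vec using (lookup; updateAt; _[_]≔_; tabulate; replicate)
open import Data.Vec.Properties
  using ( lookup∘updateAt; lookup∘updateAt′; updateAt-updateAt-local; updateAt-id; lookup∘tabulate
        ; lookup∘update; lookup∘update′; []≔-lookup )
open import Data.Vec.Relation.Binary.Pointwise.Extensional using (ext; Pointwise-≡⇒≡)
open import Data.List using (List; []; _∷_; allFin; filter)
import Data.List as List
open import Data.List.Extrema ≤-totalOrder using (argmin; argmin-all; f[argmin]≤f[xs])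
open import Data.List.Relation.Unary.All using (All; []; _∷_) renaming (lookup to All-lookup)
open import Data.List.Relation.Unary.AllPairs using (AllPairs; []; _∷_)
import Data.List.Relation.Unary.Any as Any
open import Data.List.Relation.Unary.All.Properties using (all-filter; ¬Any⇒All¬)
open import Data.List.Membership.Propositional using (_∈_)
open import Data.List.Membership.Propositional.Properties using (∈-allFin; ∈-filter⁺)
open import Data.List.Relation.Unary.Any using (here; there)
open import Data.Product using (∃; Σ; _×_; _,_; proj₁; proj₂)
open import Data.Sum using (_⊎_; inj₁; inj₂)
open import Function using (_∘_; case_of_)
open import Function.Definitions using (Injective)
open import Relation.Nullary using (Dec; yes; no; ¬_; does; contradiction)
open import Relation.Nullary.Decidable using (decidable-stable; ¬?; map′; _×-dec_; dec-true)
open import Relation.Binary.PropositionalEquality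

private
  variable
    m n : ℕ

dec-true⁻¹ : ∀ {A : Set} (a? : Dec A) → does a? ≡ true → A
dec-true⁻¹ (yes a) _ = a

∨-true-split : ∀ x {y} → x ∨ y ≡ true → x ≡ true ⊎ y ≡ true
∨-true-split true _ = inj₁ refl
∨-true-split false y≡true = inj₂ y≡true

-- pos ↦ false and neg ↦ true turn _·_ into _xor_.
bit : Sign → Bool
bit pos = false
bit neg = true

sign : Bool → Sign
sign false = pos
sign true = neg

bit-sign : ∀ b → bit (sign b) ≡ b
bit-sign false = refl
bit-sign true = refl

·-assoc : ∀ a b c → (a · b) · c ≡ a · (b · c)
·-assoc pos b c = refl
·-assoc neg pos c = refl
·-assoc neg neg pos = refl
·-assoc neg neg neg = refl

·-comm : ∀ a b → a · b ≡ b · a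
·-comm pos pos = refl
·-comm pos neg = refl
·-comm neg pos = refl
·-comm neg neg = refl

_≟ˢ_ : (a b : Sign) → Dec (a ≡ b)
pos ≟ˢ pos = yes refl
pos ≟ˢ neg = no λ ()
neg ≟ˢ pos = no λ ()
neg ≟ˢ neg = yes refl

bit-·-neg : ∀ a → bit (a · neg) ≡ not (bit a)
bit-·-neg pos = refl
bit-·-neg neg = refl

bit-·-sign : ∀ a b → bit (a · sign (bit a xor b)) ≡ b
bit-·-sign pos false = refl
bit-·-sign pos true = refl
bit-·-sign neg false = refl
bit-·-sign neg true = refl

[a·b]·c≡[a·c]·b : ∀ a b c → (a · b) · c ≡ (a · c) · b
[a·b]·c≡[a·c]·b a b c = begin
  (a · b) · c  ≡⟨ ·-assoc a b c ⟩
  a · (b · c)  ≡⟨ cong (a ·_) (·-comm b c) ⟩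
  a · (c · b)  ≡⟨ ·-assoc a c b ⟨
  (a · c) · b  ∎
  where open ≡-Reasoning

·-neg-middle : ∀ a b c → a · (b · c) ≡ neg → b ≡ neg ⊎ a · c ≡ neg
·-neg-middle a neg c _ = inj₁ refl
·-neg-middle a pos c e = inj₂ e

≢⇒·-neg : ∀ {a b} → a ≢ b → ∀ c → a · c ≡ neg ⊎ b · c ≡ neg
≢⇒·-neg {pos} {pos} a≢b c = contradiction refl a≢b
≢⇒·-neg {neg} {neg} a≢b c = contradiction refl a≢b
≢⇒·-neg {pos} {neg} _ pos = inj₂ refl
≢⇒·-neg {pos} {neg} _ neg = inj₁ refl
≢⇒·-neg {neg} {pos} _ pos = inj₁ refl
≢⇒·-neg {neg} {pos} _ neg = inj₂ refl

lookup-ext : {x y : Config n} → (∀ i → lookup x i ≡ lookup y i) → x ≡ y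
lookup-ext = Pointwise-≡⇒≡ ∘ ext

flipAt-involutive : (x : Config n) (j : Fin n) → flipAt (flipAt x j) j ≡ x
flipAt-involutive x j = trans (updateAt-updateAt-local j x (not-involutive _)) (updateAt-id j x)

flip-induction : (P : Config n → Set) (y y' : Config n) →
  (∀ z j → lookup z j ≢ lookup y' j → lookup y j ≢ lookup y' j → P z → P (flipAt z j)) →
  P y → P y'
flip-induction {n} P y y' step Py = go (allFin n) y (λ j d → ∈-allFin j , d) Py
  where
  Pending : List (Fin n) → Config n → Set
  Pending js z = ∀ j → lookup z j ≢ lookup y' j → j ∈ js × lookup y j ≢ lookup y' j

  go : ∀ js z → Pending js z → P z → P y'
  go [] z pending Pz = subst P (lookup-ext agree) Pz
    where
    agree : ∀ i → lookup z i ≡ lookup y' i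
    agree i = decidable-stable (lookup z i ≟ᵇ lookup y' i) λ d → case proj₁ (pending i d) of λ ()
  go (j ∷ js) z pending Pz with lookup z j ≟ᵇ lookup y' j
  ... | yes zj≡y'j = go js z pending′ Pz
    where
    pending′ : Pending js z
    pending′ i d with pending i d
    ... | here refl , _ = contradiction zj≡y'j d
    ... | there i∈js , dy = i∈js , dy
  ... | no zj≢y'j = go js (flipAt z j) pending′ (step z j zj≢y'j (proj₂ (pending j zj≢y'j)) Pz)
    where
    pending′ : Pending js (flipAt z j)
    pending′ i d with i ≟ᶠ j
    ... | yes refl = contradiction (trans (lookup∘updateAt i z) (sym (¬-not (≢-sym zj≢y'j)))) d
    ... | no i≢j with pending i (d ∘ trans (lookup∘updateAt′ i j i≢j z))
    ... | here refl , _ = contradiction refl i≢j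
    ... | there i∈js , dy = i∈js , dy

-- The two clauses of Arc in one: as x_j goes from 0 to 1, f_i goes from bit s to not (bit s).
ArcAt : BN n → Fin n → Fin n → Sign → Config n → Set
ArcAt f j i s x = lookup x j ≡ false × lookup (f x) i ≡ bit s × lookup (f (flipAt x j)) i ≡ not (bit s)

module _ {f : BN n} {j i : Fin n} where

  arc-witness : ∀ s → Arc f j i s → ∃ (ArcAt f j i s)
  arc-witness pos a = a
  arc-witness neg a = a

  arc-intro : ∀ s x → ArcAt f j i s x → Arc f j i s
  arc-intro pos x a = x , a
  arc-intro neg x a = x , a

  arc⇒sensitive : ∀ {s} → Arc f j i s → ∃ λ x → lookup (f x) i ≢ lookup (f (flipAt x j)) i
  arc⇒sensitive {s} a with arc-witness s a
  ... | x , _ , fx , fx′ = x , λ e → not-¬ refl (trans (sym fx) (trans e fx′))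

  sensitive⇒arc : ∀ z → lookup (f z) i ≢ lookup (f (flipAt z j)) i →
                  Arc f j i (sign (lookup z j xor lookup (f z) i))
  sensitive⇒arc z d with lookup z j in zj
  ... | false = arc-intro _ z (zj , sym (bit-sign _) , trans (¬-not (≢-sym d)) (cong not (sym (bit-sign _))))
  ... | true = arc-intro _ (flipAt z j)
        ( zj′
        , trans (¬-not (≢-sym d)) (sym (bit-sign _))
        , trans (cong (λ x → lookup (f x) i) (flipAt-involutive z j))
                (trans (sym (not-involutive _)) (cong not (sym (bit-sign _)))) )
    where
    zj′ : lookup (flipAt z j) j ≡ not true
    zj′ = trans (lookup∘updateAt j z) (cong not zj)

Influences : BN n → Fin n → Fin n → Set
Influences f j i = ∃ λ s → Arc f j i s

influences? : (f : BN n) (j i : Fin n) → Dec (Influences f j i)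
influences? f j i =
  map′ (λ (x , d) → _ , sensitive⇒arc x d) (λ (_ , a) → arc⇒sensitive a)
       (anySubset? λ x → ¬? (lookup (f x) i ≟ᵇ lookup (f (flipAt x j)) i))

Constant : (Config n → Bool) → Set
Constant h = ∀ x y → h x ≡ h y

constant? : (h : Config n → Bool) → Dec (Constant h)
constant? {n} h with anySubset? (λ x → ¬? (h x ≟ᵇ h (replicate n false)))
... | yes (x , d) = no λ c → d (c x _)
... | no none = yes λ x y → trans (at x) (sym (at y))
  where
  at : ∀ x → h x ≡ h (replicate n false)
  at x = decidable-stable (h x ≟ᵇ _) (λ d → none (x , d))

VertexSet : ℕ → Set
VertexSet m = Fin m → Bool

_⊆_ : VertexSet m → VertexSet m → Set
S ⊆ S′ = ∀ i → S i ≡ true → S′ i ≡ true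

_∖_ : VertexSet m → VertexSet m → VertexSet m
(S ∖ T) i = S i ∧ not (T i)

⁅_⁆ : Fin m → VertexSet m
⁅ v ⁆ i = does (i ≟ᶠ v)

∖-⊆ : (S T : VertexSet m) → (S ∖ T) ⊆ S
∖-⊆ S T i e with S i
... | true = refl

∈⇒∉∖ : (S : VertexSet m) {T : VertexSet m} {i : Fin m} → T i ≡ true → (S ∖ T) i ≡ false
∈⇒∉∖ S {i = i} i∈T rewrite i∈T = ∧-zeroʳ (S i)

[S∖⁅i⁆]j≡Sj : (S : VertexSet m) {i j : Fin m} → j ≢ i → (S ∖ ⁅ i ⁆) j ≡ S j
[S∖⁅i⁆]j≡Sj S {i} {j} j≢i with j ≟ᶠ i
... | yes j≡i = contradiction j≡i j≢i
... | no _ = ∧-identityʳ (S j)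

∣_∣ : VertexSet m → ℕ
∣_∣ {zero} S = 0
∣_∣ {suc m} S = if S zero then suc ∣ S ∘ suc ∣ else ∣ S ∘ suc ∣

∣S∣≤m : (S : VertexSet m) → ∣ S ∣ ≤ m
∣S∣≤m {zero} S = z≤n
∣S∣≤m {suc m} S with S zero
... | true = s≤s (∣S∣≤m (S ∘ suc))
... | false = ≤-trans (∣S∣≤m (S ∘ suc)) (n≤1+n m)

∣full∣≡m : ∣ (λ (_ : Fin m) → true) ∣ ≡ m
∣full∣≡m {zero} = refl
∣full∣≡m {suc m} = cong suc ∣full∣≡m

∣empty∣≡0 : (S : VertexSet m) → (∀ i → S i ≡ false) → ∣ S ∣ ≡ 0
∣empty∣≡0 {zero} S _ = refl
∣empty∣≡0 {suc m} S empty rewrite empty zero = ∣empty∣≡0 (S ∘ suc) (empty ∘ suc)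

⊆⇒∣∣≤ : {S S′ : VertexSet m} → S ⊆ S′ → ∣ S ∣ ≤ ∣ S′ ∣
⊆⇒∣∣≤ {zero} _ = z≤n
⊆⇒∣∣≤ {suc m} {S} {S′} S⊆S′ with S zero in s | S′ zero in s′
... | true | true = s≤s (⊆⇒∣∣≤ (S⊆S′ ∘ suc))
... | false | true = ≤-trans (⊆⇒∣∣≤ (S⊆S′ ∘ suc)) (n≤1+n _)
... | false | false = ⊆⇒∣∣≤ (S⊆S′ ∘ suc)
... | true | false = contradiction (trans (sym (S⊆S′ zero s)) s′) λ ()

⊂⇒∣∣< : {S S′ : VertexSet m} → S ⊆ S′ → ∀ i → S′ i ≡ true → S i ≡ false → ∣ S ∣ < ∣ S′ ∣
⊂⇒∣∣< {suc m} {S} {S′} S⊆S′ zero s′ s rewrite s | s′ = s≤s (⊆⇒∣∣≤ (S⊆S′ ∘ suc))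
⊂⇒∣∣< {suc m} {S} {S′} S⊆S′ (suc i) s′ s with S zero in s₀ | S′ zero in s′₀
... | true | true = s≤s (⊂⇒∣∣< (S⊆S′ ∘ suc) i s′ s)
... | false | true = ≤-trans (⊂⇒∣∣< (S⊆S′ ∘ suc) i s′ s) (n≤1+n _)
... | false | false = ⊂⇒∣∣< (S⊆S′ ∘ suc) i s′ s
... | true | false = contradiction (trans (sym (S⊆S′ zero s₀)) s′₀) λ ()

∣∣-cong : {S S′ : VertexSet m} → (∀ i → S i ≡ S′ i) → ∣ S ∣ ≡ ∣ S′ ∣
∣∣-cong {zero} _ = refl
∣∣-cong {suc m} {S} {S′} eq rewrite eq zero with S′ zero
... | true = cong suc (∣∣-cong (eq ∘ suc))
... | false = ∣∣-cong (eq ∘ suc)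

∣∣-remove : {S S′ : VertexSet m} (i : Fin m) → S i ≡ true → S′ i ≡ false →
            (∀ j → j ≢ i → S′ j ≡ S j) → ∣ S ∣ ≡ suc ∣ S′ ∣
∣∣-remove {suc m} zero s s′ same rewrite s | s′ = cong suc (∣∣-cong λ j → sym (same (suc j) λ ()))
∣∣-remove {suc m} {S} {S′} (suc i) s s′ same rewrite same zero (λ ()) with S zero
... | true = cong suc (∣∣-remove i s s′ λ j j≢i → same (suc j) (j≢i ∘ suc-injective))
... | false = ∣∣-remove i s s′ λ j j≢i → same (suc j) (j≢i ∘ suc-injective)

∣S∣≡1+∣S∖⁅i⁆∣ : (S : VertexSet m) {i : Fin m} → S i ≡ true → ∣ S ∣ ≡ suc ∣ S ∖ ⁅ i ⁆ ∣
∣S∣≡1+∣S∖⁅i⁆∣ S {i} i∈S =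
  ∣∣-remove i i∈S (∈⇒∉∖ S {⁅ i ⁆} (dec-true (i ≟ᶠ i) refl)) λ j → [S∖⁅i⁆]j≡Sj S

module Iteration (F : VertexSet m → VertexSet m) (F-extensive : ∀ S → S ⊆ F S) (S₀ : VertexSet m) where

  stage : ℕ → VertexSet m
  stage zero = S₀
  stage (suc ℓ) = F (stage ℓ)

  stage-invariant : (P : Fin m → Set) → (∀ i → S₀ i ≡ true → P i) →
                    (∀ S → (∀ i → S i ≡ true → P i) → ∀ i → F S i ≡ true → P i) →
                    ∀ ℓ i → stage ℓ i ≡ true → P i
  stage-invariant P base step zero = base
  stage-invariant P base step (suc ℓ) = step (stage ℓ) (stage-invariant P base step ℓ)

  S₀⊆stage : ∀ ℓ → S₀ ⊆ stage ℓ
  S₀⊆stage zero i i∈S₀ = i∈S₀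
  S₀⊆stage (suc ℓ) i i∈S₀ = F-extensive _ i (S₀⊆stage ℓ i i∈S₀)

  -- Each stage that is not yet stable gains an element, and there are only m of them.
  stabilises : ∃ λ ℓ → F (stage ℓ) ⊆ stage ℓ
  stabilises with stable-or-large (suc m)
    where
    stable-or-large : ∀ ℓ → (∃ λ k → F (stage k) ⊆ stage k) ⊎ ℓ ≤ ∣ stage ℓ ∣
    stable-or-large zero = inj₂ z≤n
    stable-or-large (suc ℓ) with stable-or-large ℓ
    ... | inj₁ stable = inj₁ stable
    ... | inj₂ large with any? (λ i → (F (stage ℓ) i ≟ᵇ true) ×-dec (stage ℓ i ≟ᵇ false))
    ...   | yes (i , new , old) = inj₂ (≤-trans (s≤s large) (⊂⇒∣∣< (F-extensive _) i new old))
    ...   | no none = inj₁ (ℓ , stable)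
      where
      stable : F (stage ℓ) ⊆ stage ℓ
      stable i new with stage ℓ i in old
      ... | true = refl
      ... | false = contradiction (i , new , old) none
  ... | inj₁ stable = stable
  ... | inj₂ large = contradiction (∣S∣≤m (stage (suc m))) (<⇒≱ large)

minimiser : (c : Fin m → ℕ) (R : VertexSet m) {v₀ : Fin m} → R v₀ ≡ true →
            ∃ λ v → R v ≡ true × ∀ u → R u ≡ true → c v ≤ c u
minimiser {m} c R {v₀} r₀ =
  argmin c v₀ inR , argmin-all c r₀ (all-filter inR? (allFin m)) ,
  λ u r → All-lookup (f[argmin]≤f[xs] v₀ inR) (∈-filter⁺ inR? (∈-allFin u) r)
  where
  inR? = λ u → R u ≟ᵇ true
  inR = filter inR? (allFin m)

next-cases : ∀ {k} (m : Fin (suc k)) →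
             suc m ≡ inject₁ (next m) ⊎ (suc m ≡ fromℕ (suc k) × next m ≡ zero)
next-cases {k} m with suc (toℕ m) <? suc k
... | yes m+1<k+1 = inj₁ (toℕ-injective (sym (trans (toℕ-inject₁ _) (toℕ-fromℕ< m+1<k+1))))
... | no m+1≮k+1 =
  inj₂ (toℕ-injective (trans (≤-antisym (toℕ<n m) (≮⇒≥ m+1≮k+1)) (sym (toℕ-fromℕ (suc k)))) , refl)

module Walks (g : BN n) where

  infixr 5 _∷_ _++_

  data Walk : Fin n → Fin n → Set where
    [] : ∀ {a} → Walk a a
    _∷_ : ∀ {a b c s} → Arc g a b s → Walk b c → Walk a c

  private
    variable
      a b c x : Fin n

  sgn : Walk a b → Sign
  sgn [] = pos
  sgn (_∷_ {s = s} _ p) = s · sgn p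

  length : Walk a b → ℕ
  length [] = 0
  length (_ ∷ p) = suc (length p)

  sources : Walk a b → List (Fin n)
  sources [] = []
  sources (_∷_ {a} _ p) = a ∷ sources p

  _++_ : Walk a b → Walk b c → Walk a c
  [] ++ q = q
  (e ∷ p) ++ q = e ∷ (p ++ q)

  sgn-++ : (p : Walk a b) (q : Walk b c) → sgn (p ++ q) ≡ sgn p · sgn q
  sgn-++ [] q = refl
  sgn-++ (_∷_ {s = s} _ p) q = trans (cong (s ·_) (sgn-++ p q)) (sym (·-assoc s (sgn p) (sgn q)))

  length-++ : (p : Walk a b) (q : Walk b c) → length (p ++ q) ≡ length p + length q
  length-++ [] q = refl
  length-++ (_ ∷ p) q = cong suc (length-++ p q)

  vertexAt : (p : Walk a b) → Fin (suc (length p)) → Fin n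
  vertexAt {a} p zero = a
  vertexAt (_ ∷ p) (suc i) = vertexAt p i

  signAt : (p : Walk a b) → Fin (length p) → Sign
  signAt (_∷_ {s = s} _ p) zero = s
  signAt (_ ∷ p) (suc i) = signAt p i

  arcAt : (p : Walk a b) (i : Fin (length p)) →
          Arc g (vertexAt p (inject₁ i)) (vertexAt p (suc i)) (signAt p i)
  arcAt (e ∷ p) zero = e
  arcAt (e ∷ p) (suc i) = arcAt p i

  vertexAt-last : (p : Walk a b) → vertexAt p (fromℕ (length p)) ≡ b
  vertexAt-last [] = refl
  vertexAt-last (e ∷ p) = vertexAt-last p

  prodSign-signAt : (p : Walk a b) → prodSign (signAt p) ≡ sgn p
  prodSign-signAt [] = refl
  prodSign-signAt (_∷_ {s = s} _ p) = cong (s ·_) (prodSign-signAt p)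

  All-sources : {P : Fin n → Set} (p : Walk a b) → All P (sources p) →
                (i : Fin (length p)) → P (vertexAt p (inject₁ i))
  All-sources (e ∷ p) (Pa ∷ _) zero = Pa
  All-sources (e ∷ p) (_ ∷ Pps) (suc i) = All-sources p Pps i

  vertexAt-injective : (p : Walk a b) → AllPairs _≢_ (sources p) →
                       Injective _≡_ _≡_ (vertexAt p ∘ inject₁)
  vertexAt-injective (e ∷ p) (a∉p ∷ distinct) {zero} {zero} _ = refl
  vertexAt-injective (e ∷ p) (a∉p ∷ distinct) {zero} {suc j} eq = contradiction eq (All-sources p a∉p j)
  vertexAt-injective (e ∷ p) (a∉p ∷ distinct) {suc i} {zero} eq = contradiction (sym eq) (All-sources p a∉p i)
  vertexAt-injective (e ∷ p) (a∉p ∷ distinct) {suc i} {suc j} eq = cong suc (vertexAt-injective p distinct eq)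

  simple-cycle : ∀ {s} (e : Arc g a b s) (p : Walk b a) → AllPairs _≢_ (sources (e ∷ p)) →
                 Σ (Cycle g) λ C → prodSign (Cycle.s C) ≡ sgn (e ∷ p)
  simple-cycle e p distinct =
    record { k = length p ; v = vertexAt w ∘ inject₁ ; v-inj = vertexAt-injective w distinct
           ; s = signAt w
           ; arcs = λ m → subst (λ z → Arc g (vertexAt w (inject₁ m)) z (signAt w m)) (closes m) (arcAt w m) } ,
    prodSign-signAt w
    where
    w = e ∷ p
    closes : ∀ m → vertexAt w (suc m) ≡ vertexAt w (inject₁ (next m))
    closes m with next-cases m
    ... | inj₁ eq = cong (vertexAt w) eq
    ... | inj₂ (last , wraps) =
          trans (cong (vertexAt w) last) (trans (vertexAt-last w) (cong (vertexAt w ∘ inject₁) (sym wraps)))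

  data SplitAt (x : Fin n) : Walk a b → Set where
    split : ∀ {c s} (q : Walk a x) (e : Arc g x c s) (r : Walk c b) → SplitAt x (q ++ e ∷ r)

  split-at : (p : Walk a b) → x ∈ sources p → SplitAt x p
  split-at (e ∷ p) (here refl) = split [] e p
  split-at (e ∷ p) (there x∈p) with split-at p x∈p
  ... | split q e′ r = split (e ∷ q) e′ r

  data Detour : Walk a b → Set where
    detour : (q : Walk a x) (r : Walk x x) (t : Walk x b) → 0 < length r → 0 < length t →
             Detour (q ++ r ++ t)

  simple-or-detour : (p : Walk a b) → AllPairs _≢_ (sources p) ⊎ Detour p
  simple-or-detour [] = inj₁ []
  simple-or-detour (_∷_ {a} e p) with Any.any? (a ≟ᶠ_) (sources p)
  ... | yes a∈p with split-at p a∈p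
  ...   | split q e′ r = inj₂ (detour [] (e ∷ q) (e′ ∷ r) (s≤s z≤n) (s≤s z≤n))
  simple-or-detour (e ∷ p) | no a∉p with simple-or-detour p
  ... | inj₁ distinct = inj₁ (¬Any⇒All¬ _ a∉p ∷ distinct)
  ... | inj₂ (detour q r t r≢[] t≢[]) = inj₂ (detour (e ∷ q) r t r≢[] t≢[])

  sgn-detour : (q : Walk a x) (r : Walk x x) (t : Walk x b) → sgn (q ++ r ++ t) ≡ neg →
               sgn r ≡ neg ⊎ sgn (q ++ t) ≡ neg
  sgn-detour q r t negative with ·-neg-middle (sgn q) (sgn r) (sgn t) split-sign
    where
    split-sign : sgn q · (sgn r · sgn t) ≡ neg
    split-sign = trans (sym (trans (sgn-++ q (r ++ t)) (cong (sgn q ·_) (sgn-++ r t)))) negative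
  ... | inj₁ r-negative = inj₁ r-negative
  ... | inj₂ qt-negative = inj₂ (trans (sgn-++ q t) qt-negative)

  detour-shortens : (q : Walk a x) (r : Walk x x) (t : Walk x b) → 0 < length r → 0 < length t →
                    length r < length (q ++ r ++ t) × length (q ++ t) < length (q ++ r ++ t)
  detour-shortens q r t r≢[] t≢[]
    rewrite length-++ q (r ++ t) | length-++ r t | length-++ q t =
    ≤-trans (m<m+n (length r) t≢[]) (m≤n+m _ (length q)) ,
    +-monoʳ-< (length q) (m<n+m (length t) r≢[])

  -- A closed walk that is not a cycle splits into two shorter closed walks whose signs
  -- multiply to its own.
  negative-closed-walk⇒negative-cycle : (p : Walk a a) → sgn p ≡ neg → NegativeCycle g
  negative-closed-walk⇒negative-cycle p = <-rec Claim step (length p) p refl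
    where
    Claim : ℕ → Set
    Claim ℓ = ∀ {a} (p : Walk a a) → length p ≡ ℓ → sgn p ≡ neg → NegativeCycle g

    step : ∀ ℓ → (∀ {ℓ′} → ℓ′ < ℓ → Claim ℓ′) → Claim ℓ
    step _ shorter p refl negative with simple-or-detour p
    ... | inj₂ (detour q r t r≢[] t≢[]) with detour-shortens q r t r≢[] t≢[] | sgn-detour q r t negative
    ...   | r-shorter , _ | inj₁ r-negative = shorter r-shorter r refl r-negative
    ...   | _ , qt-shorter | inj₂ qt-negative = shorter qt-shorter (q ++ t) refl qt-negative
    step _ shorter [] refl () | inj₁ _
    step _ shorter (e ∷ p) refl negative | inj₁ distinct with simple-cycle e p distinct
    ... | C , sgnC = C , trans sgnC negative

module Ancestors (g : BN n) where
  open Walks g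

  PredecessorClosed : VertexSet n → Set
  PredecessorClosed S = ∀ {u w} → S w ≡ true → Influences g u w → S u ≡ true

  withPredecessors : VertexSet n → VertexSet n
  withPredecessors S u = S u ∨ does (any? λ w → (S w ≟ᵇ true) ×-dec influences? g u w)

  withPredecessors-cases : ∀ {S u} → withPredecessors S u ≡ true →
                           S u ≡ true ⊎ ∃ λ w → S w ≡ true × Influences g u w
  withPredecessors-cases {S} {u} e with ∨-true-split (S u) e
  ... | inj₁ u∈S = inj₁ u∈S
  ... | inj₂ found = inj₂ (dec-true⁻¹ (any? _) found)

  withPredecessors-extensive : ∀ S → S ⊆ withPredecessors S
  withPredecessors-extensive S u u∈S rewrite u∈S = refl

  private
    module Stages (v : Fin n) = Iteration withPredecessors withPredecessors-extensive ⁅ v ⁆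
    open Stages

    depth : Fin n → ℕ
    depth v = proj₁ (stabilises v)

  -- Kept abstract so that type checking never unfolds the stabilisation search.
  abstract
    ancestors : Fin n → VertexSet n
    ancestors v = stage v (depth v)

    ancestors-closed : ∀ v → PredecessorClosed (ancestors v)
    ancestors-closed v {u} {w} w∈A (s , arc) = proj₂ (stabilises v) u
      (trans (cong (ancestors v u ∨_) (dec-true (any? _) (w , w∈A , s , arc))) (∨-zeroʳ _))

    ancestors-self : ∀ v → ancestors v v ≡ true
    ancestors-self v = S₀⊆stage v (depth v) v (dec-true (v ≟ᶠ v) refl)

    ancestors-least : ∀ {v S} → PredecessorClosed S → S v ≡ true → ancestors v ⊆ S
    ancestors-least {v} {S} closed v∈S = stage-invariant v (λ i → S i ≡ true) base step (depth v)
      where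
      base : ⁅ v ⁆ ⊆ S
      base i i≡v = subst (λ j → S j ≡ true) (sym (dec-true⁻¹ (i ≟ᶠ v) i≡v)) v∈S
      step : ∀ S′ → S′ ⊆ S → withPredecessors S′ ⊆ S
      step S′ S′⊆S u e with withPredecessors-cases e
      ... | inj₁ u∈S′ = S′⊆S u u∈S′
      ... | inj₂ (w , w∈S′ , influence) = closed (S′⊆S w w∈S′) influence

    ancestors-walk : ∀ {v u} → ancestors v u ≡ true → Walk u v
    ancestors-walk {v} = stage-invariant v (λ u → Walk u v) base step (depth v) _
      where
      base : ∀ u → ⁅ v ⁆ u ≡ true → Walk u v
      base u u≡v rewrite dec-true⁻¹ (u ≟ᶠ v) u≡v = []
      step : ∀ S → (∀ w → S w ≡ true → Walk w v) → ∀ u → withPredecessors S u ≡ true → Walk u v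
      step S walks u e with withPredecessors-cases e
      ... | inj₁ u∈S = walks u u∈S
      ... | inj₂ (w , w∈S , _ , arc) = arc ∷ walks w w∈S

  record InitialComponent (R : VertexSet n) : Set where
    field
      T : VertexSet n
      T⊆R : T ⊆ R
      T-closed : PredecessorClosed T
      hub : Fin n
      hub∈T : T hub ≡ true
      connected : ∀ {u} → T u ≡ true → Walk hub u × Walk u hub

  -- The ancestor set of a vertex of R with the fewest ancestors is strongly connected:
  -- any of its members has no more ancestors, hence the same ones.
  initial-component : ∀ {R v₀} → PredecessorClosed R → R v₀ ≡ true → InitialComponent R
  initial-component {R} R-closed v₀∈R with minimiser (λ u → ∣ ancestors u ∣) R v₀∈R
  ... | v , v∈R , fewest = record
    { T = ancestors v ; T⊆R = ancestors-least R-closed v∈R ; T-closed = ancestors-closed v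
    ; hub = v ; hub∈T = ancestors-self v
    ; connected = λ u∈T → ancestors-walk (v∈ancestors u∈T) , ancestors-walk u∈T }
    where
    v∈ancestors : ∀ {u} → ancestors v u ≡ true → ancestors u v ≡ true
    v∈ancestors {u} u∈T with ancestors u v in e
    ... | true = refl
    ... | false = contradiction (fewest u (ancestors-least R-closed v∈R u u∈T))
                    (<⇒≱ (⊂⇒∣∣< (ancestors-least (ancestors-closed v) u∈T) v (ancestors-self v) e))

Balanced : BN n → VertexSet n → (Fin n → Sign) → Set
Balanced g T σ = ∀ {j u s} → T j ≡ true → T u ≡ true → Arc g j u s → σ u ≡ σ j · s

balanced-negate : ∀ {g : BN n} {T σ} → Balanced g T σ → Balanced g T (λ u → σ u · neg)
balanced-negate {σ = σ} balanced {j} {u} {s} j∈T u∈T arc =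
  trans (cong (_· neg) (balanced j∈T u∈T arc)) ([a·b]·c≡[a·c]·b (σ j) s neg)

module _ (g : BN n) where
  open Walks g

  -- Sign each vertex by a walk from the hub; a conflict on an arc j → u closes a negative walk
  -- through the hub, either along the arc or without it.
  balanced-labelling : NoNegativeCycle g → (T : VertexSet n) (hub : Fin n) →
                       (∀ {u} → T u ≡ true → Walk hub u × Walk u hub) → ∃ (Balanced g T)
  balanced-labelling noNegative T hub connected = σ , balanced
    where
    σ : Fin n → Sign
    σ u with T u ≟ᵇ true
    ... | yes u∈T = sgn (proj₁ (connected u∈T))
    ... | no _ = pos

    labelled : ∀ {u} → T u ≡ true → ∃ λ (p : Walk hub u) → sgn p ≡ σ u
    labelled {u} u∈T with T u ≟ᵇ true
    ... | yes u∈T′ = proj₁ (connected u∈T′) , refl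
    ... | no u∉T = contradiction u∈T u∉T

    back : ∀ {u} → T u ≡ true → Walk u hub
    back u∈T = proj₂ (connected u∈T)

    conflict⇒negative-cycle : ∀ {j u s} → T j ≡ true → T u ≡ true → Arc g j u s →
                              σ u ≢ σ j · s → NegativeCycle g
    conflict⇒negative-cycle {j} {u} {s} j∈T u∈T arc conflict
      with labelled j∈T | labelled u∈T | ≢⇒·-neg (conflict ∘ sym) (sgn (back u∈T))
    ... | pj , pj≡σj | _ , _ | inj₁ negative =
          negative-closed-walk⇒negative-cycle (pj ++ arc ∷ back u∈T) (begin
            sgn (pj ++ arc ∷ back u∈T)         ≡⟨ sgn-++ pj (arc ∷ back u∈T) ⟩
            sgn pj · (s · sgn (back u∈T))     ≡⟨ cong (_· (s · sgn (back u∈T))) pj≡σj ⟩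
            σ j · (s · sgn (back u∈T))        ≡⟨ ·-assoc (σ j) s (sgn (back u∈T)) ⟨
            (σ j · s) · sgn (back u∈T)        ≡⟨ negative ⟩
            neg                               ∎)
      where open ≡-Reasoning
    ... | _ , _ | pu , pu≡σu | inj₂ negative =
          negative-closed-walk⇒negative-cycle (pu ++ back u∈T)
            (trans (sgn-++ pu (back u∈T)) (trans (cong (_· sgn (back u∈T)) pu≡σu) negative))

    balanced : Balanced g T σ
    balanced {j} {u} {s} j∈T u∈T arc =
      decidable-stable (σ u ≟ˢ (σ j · s)) (noNegative ∘ conflict⇒negative-cycle j∈T u∈T arc)

_≈[_]_ : Config n → VertexSet n → Config n → Set
x ≈[ T ] t = ∀ i → T i ≡ true → lookup x i ≡ lookup t i

TrapSpace : BN n → VertexSet n → Config n → Set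
TrapSpace g T t = ∀ x → x ≈[ T ] t → g x ≈[ T ] t

signConfig : (Fin n → Sign) → Config n
signConfig σ = tabulate (bit ∘ σ)

-- If u missed its label at β, every flip on the way from β to any y would keep it so:
-- a flip of j that changes u is an arc j → u inside T, and balance fixes its effect.
balanced⇒trapSpace : ∀ {g : BN n} {T σ} → Ancestors.PredecessorClosed g T →
                     (∀ {u} → T u ≡ true → ¬ Constant (λ x → lookup (g x) u)) →
                     Balanced g T σ → TrapSpace g T (signConfig σ)
balanced⇒trapSpace {g = g} {T} {σ} closed varying balanced β β≈σ u u∈T =
  trans (decidable-stable (_ ≟ᵇ _) λ missed → varying u∈T (constant missed))
        (sym (lookup∘tabulate (bit ∘ σ) u))
  where
  β≈bit : ∀ j → T j ≡ true → lookup β j ≡ bit (σ j)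
  β≈bit j j∈T = trans (β≈σ j j∈T) (lookup∘tabulate (bit ∘ σ) j)

  keeps-missing : ∀ y z j → lookup z j ≢ lookup y j → lookup β j ≢ lookup y j →
                  lookup (g z) u ≡ not (bit (σ u)) → lookup (g (flipAt z j)) u ≡ not (bit (σ u))
  keeps-missing y z j z≢y β≢y missing with lookup (g (flipAt z j)) u ≟ᵇ lookup (g z) u
  ... | yes unchanged = trans unchanged missing
  ... | no changed = contradiction (begin
        bit (σ u)                                          ≡⟨ cong bit (balanced j∈T u∈T arc) ⟩
        bit (σ j · sign (lookup z j xor lookup (g z) u))   ≡⟨ cong (λ b → bit (σ j · sign (b xor _))) zj≡σj ⟩
        bit (σ j · sign (bit (σ j) xor lookup (g z) u))    ≡⟨ bit-·-sign (σ j) _ ⟩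
        lookup (g z) u                                     ≡⟨ missing ⟩
        not (bit (σ u))                                    ∎) (not-¬ refl)
    where
    open ≡-Reasoning
    arc = sensitive⇒arc z (changed ∘ sym)
    j∈T = closed u∈T (_ , arc)
    zj≡σj : lookup z j ≡ bit (σ j)
    zj≡σj = trans (trans (¬-not z≢y) (sym (¬-not β≢y))) (β≈bit j j∈T)

  constant : lookup (g β) u ≢ bit (σ u) → Constant (λ x → lookup (g x) u)
  constant missed x y = trans (always x) (sym (always y))
    where
    always : ∀ y → lookup (g y) u ≡ not (bit (σ u))
    always y = flip-induction (λ z → lookup (g z) u ≡ not (bit (σ u))) β y (keeps-missing y) (¬-not missed)

-- Kept abstract so that T and t can be inferred from override T t x.
abstract
  override : VertexSet n → Config n → Config n → Config n
  override T t x = tabulate λ i → if T i then lookup t i else lookup x i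

  override-≈ : ∀ {T : VertexSet n} {t} x → override T t x ≈[ T ] t
  override-≈ {T = T} {t} x i i∈T
    rewrite lookup∘tabulate (λ i → if T i then lookup t i else lookup x i) i | i∈T = refl

  lookup-override-∉ : ∀ {T : VertexSet n} {t} x {i} → T i ≡ false → lookup (override T t x) i ≡ lookup x i
  lookup-override-∉ {T = T} {t} x {i} i∉T
    rewrite lookup∘tabulate (λ i → if T i then lookup t i else lookup x i) i | i∉T = refl

module _ {T : VertexSet n} {t : Config n} where

  override-id : ∀ {x} → x ≈[ T ] t → override T t x ≡ x
  override-id {x} x≈t = lookup-ext λ i → case i (T i) refl
    where
    case : ∀ i b → T i ≡ b → lookup (override T t x) i ≡ lookup x i
    case i true i∈T = trans (override-≈ x i i∈T) (sym (x≈t i i∈T))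
    case i false i∉T = lookup-override-∉ x i∉T

  override-flipAt-∈ : ∀ x {j} → T j ≡ true → override T t (flipAt x j) ≡ override T t x
  override-flipAt-∈ x {j} j∈T = lookup-ext λ i → case i (T i) refl
    where
    case : ∀ i b → T i ≡ b → lookup (override T t (flipAt x j)) i ≡ lookup (override T t x) i
    case i true i∈T = trans (override-≈ _ i i∈T) (sym (override-≈ x i i∈T))
    case i false i∉T with i ≟ᶠ j
    ... | yes refl = contradiction (trans (sym i∉T) j∈T) λ ()
    ... | no i≢j = trans (lookup-override-∉ _ i∉T)
                     (trans (lookup∘updateAt′ i j i≢j x) (sym (lookup-override-∉ x i∉T)))

  override-flipAt-∉ : ∀ x {j} → T j ≡ false → override T t (flipAt x j) ≡ flipAt (override T t x) j
  override-flipAt-∉ x {j} j∉T = lookup-ext λ i → case i (T i) refl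
    where
    case : ∀ i b → T i ≡ b → lookup (override T t (flipAt x j)) i ≡ lookup (flipAt (override T t x) j) i
    case i true i∈T with i ≟ᶠ j
    ... | yes refl = contradiction (trans (sym i∈T) j∉T) λ ()
    ... | no i≢j = trans (override-≈ _ i i∈T)
                     (trans (sym (override-≈ x i i∈T)) (sym (lookup∘updateAt′ i j i≢j (override T t x))))
    case i false i∉T with i ≟ᶠ j
    ... | yes refl = trans (lookup-override-∉ _ i∉T)
                       (trans (lookup∘updateAt i x)
                         (trans (cong not (sym (lookup-override-∉ x i∉T)))
                                (sym (lookup∘updateAt i (override T t x)))))
    ... | no i≢j = trans (lookup-override-∉ _ i∉T)
                     (trans (lookup∘updateAt′ i j i≢j x)
                       (trans (sym (lookup-override-∉ x i∉T))
                              (sym (lookup∘updateAt′ i j i≢j (override T t x)))))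

Confined : BN n → VertexSet n → Set
Confined g R = ∀ {v} → R v ≡ false → Constant (λ x → lookup (g x) v) × (∀ {i s} → ¬ Arc g v i s)

module Freeze (g : BN n) (T : VertexSet n) (t : Config n) where

  frozen : BN n
  frozen x = g (override T t x)

  frozen-ignores : ∀ x {j} → T j ≡ true → frozen (flipAt x j) ≡ frozen x
  frozen-ignores x j∈T = cong g (override-flipAt-∈ x j∈T)

  frozen-arc : ∀ {j i s} → Arc frozen j i s → Arc g j i s
  frozen-arc {j} {i} {s} arc with T j in j∈T
  ... | true = contradiction (cong (λ y → lookup y i) (sym (frozen-ignores x j∈T))) sensitive
    where
    x = proj₁ (arc⇒sensitive arc)
    sensitive = proj₂ (arc⇒sensitive arc)
  ... | false with arc-witness s arc
  ... | x , xj , before , after =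
        arc-intro s (override T t x)
          ( trans (lookup-override-∉ x j∈T) xj , before
          , trans (cong (λ y → lookup (g y) i) (sym (override-flipAt-∉ x j∈T))) after )

  frozen-noNegativeCycle : NoNegativeCycle g → NoNegativeCycle frozen
  frozen-noNegativeCycle noNegative (C , negative) = noNegative (C′ , negative)
    where
    open Cycle C
    C′ : Cycle g
    C′ = record { k = k ; v = v ; v-inj = v-inj ; s = s ; arcs = frozen-arc ∘ arcs }

  fixed⇒frozen-fixed : ∀ {x} → x ≈[ T ] t → g x ≡ x → frozen x ≡ x
  fixed⇒frozen-fixed x≈t fixed = trans (cong g (override-id x≈t)) fixed

  module _ (trap : TrapSpace g T t) where

    frozen-≈ : ∀ x → frozen x ≈[ T ] t
    frozen-≈ x = trap _ (override-≈ x)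

    frozen-fixed⇒fixed : ∀ {x} → frozen x ≡ x → g x ≡ x
    frozen-fixed⇒fixed {x} fixed = trans (cong g (sym (override-id x≈t))) fixed
      where
      x≈t : x ≈[ T ] t
      x≈t i i∈T = trans (cong (λ y → lookup y i) (sym fixed)) (frozen-≈ x i i∈T)

    frozen-confined : ∀ {R} → Confined g R → T ⊆ R → Confined frozen (R ∖ T)
    frozen-confined {R} confined T⊆R {v} v∉R∖T with T v in v∈T
    ... | true = (λ x y → trans (frozen-≈ x v v∈T) (sym (frozen-≈ y v v∈T))) ,
                 λ arc → let (x , sensitive) = arc⇒sensitive arc
                         in sensitive (cong (λ y → lookup y _) (sym (frozen-ignores x v∈T)))
    ... | false with confined (trans (sym (∧-identityʳ (R v))) v∉R∖T)
    ... | constant , no-arc = (λ x y → constant _ _) , no-arc ∘ frozen-arc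

    updComp-≈ : ∀ i x → x ≈[ T ] t → updComp g i x ≈[ T ] t
    updComp-≈ i x x≈t j j∈T with j ≟ᶠ i
    ... | yes refl = trans (lookup∘update j x _) (trap x x≈t j j∈T)
    ... | no j≢i = trans (lookup∘update′ j≢i x _) (x≈t j j∈T)

    updWord-frozen : ∀ w x → x ≈[ T ] t → updWord g w x ≡ updWord frozen w x
    updWord-frozen [] x x≈t = refl
    updWord-frozen (i ∷ w) x x≈t =
      trans (updWord-frozen w (updComp g i x) (updComp-≈ i x x≈t))
            (cong (λ y → updWord frozen w (x [ i ]≔ lookup (g y) i)) (sym (override-id x≈t)))

updWord-fixed : ∀ {f : BN n} w {x} → IsFixedPoint f x → updWord f w x ≡ x
updWord-fixed [] fixed = refl
updWord-fixed {f = f} (i ∷ w) {x} fixed =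
  trans (cong (updWord f w) (trans (cong (λ y → x [ i ]≔ lookup y i) fixed) ([]≔-lookup x i)))
        (updWord-fixed {f = f} w fixed)

synchronizing⇒fixedPoint-unique : ∀ {f : BN n} w {x y} → IsSynchronizingWord f w →
                                  IsFixedPoint f x → IsFixedPoint f y → x ≡ y
synchronizing⇒fixedPoint-unique {f = f} w {x} {y} sync x-fixed y-fixed =
  trans (sym (updWord-fixed {f = f} w x-fixed)) (trans (sync x y) (updWord-fixed {f = f} w y-fixed))

HasFixedPoint : BN n → Set
HasFixedPoint f = ∃ (IsFixedPoint f)

Synchronizes : BN n → VertexSet n → List (Fin n) → Set
Synchronizes g R w = ∀ x y → (∀ i → R i ≡ false → lookup x i ≡ lookup y i) → updWord g w x ≡ updWord g w y

Conclusion : BN n → VertexSet n → ℕ → Set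
Conclusion g R k = HasFixedPoint g × (UniqueFixedPoint g → ∃ λ w → List.length w ≡ k × Synchronizes g R w)

Claim : ℕ → ℕ → Set
Claim n k = ∀ (g : BN n) R → ∣ R ∣ ≡ k → Confined g R → NoNegativeCycle g → Conclusion g R k

module InductionStep {k} (IH : ∀ {k′} → k′ < k → Claim n k′) (g : BN n) (R : VertexSet n)
                     (∣R∣≡k : ∣ R ∣ ≡ k) (confined : Confined g R) (noNegative : NoNegativeCycle g) where

  empty-case : (∀ i → R i ≡ false) → Conclusion g R k
  empty-case empty =
    (g (replicate n false) , lookup-ext λ i → proj₁ (confined (empty i)) _ _) ,
    λ _ → [] , trans (sym (∣empty∣≡0 R empty)) ∣R∣≡k , λ x y agree → lookup-ext λ i → agree i (empty i)

  fixedPoint-in-trap : ∀ {T t i} → TrapSpace g T t → T ⊆ R → T i ≡ true →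
                       ∃ λ x → IsFixedPoint g x × x ≈[ T ] t
  fixedPoint-in-trap {T} {t} {i} trap T⊆R i∈T = x , frozen-fixed⇒fixed trap fixed , x≈t
    where
    open Freeze g T t
    smaller : ∣ R ∖ T ∣ < k
    smaller = subst (∣ R ∖ T ∣ <_) ∣R∣≡k (⊂⇒∣∣< (∖-⊆ R T) i (T⊆R i i∈T) (∈⇒∉∖ R {T} i∈T))
    frozenFixedPoint : HasFixedPoint frozen
    frozenFixedPoint = proj₁ (IH smaller frozen (R ∖ T) refl (frozen-confined trap confined T⊆R)
                                 (frozen-noNegativeCycle noNegative))
    x = proj₁ frozenFixedPoint
    fixed = proj₂ frozenFixedPoint
    x≈t : x ≈[ T ] t
    x≈t j j∈T = trans (cong (λ y → lookup y j) (sym fixed)) (frozen-≈ trap x j j∈T)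

  constant-case : ∀ {u} → R u ≡ true → Constant (λ x → lookup (g x) u) → Conclusion g R k
  constant-case {u} u∈R constant = (x , frozen-fixed⇒fixed trap fixed) , synchronizing
    where
    t = g (replicate n false)
    open Freeze g ⁅ u ⁆ t

    g≈t : ∀ x → g x ≈[ ⁅ u ⁆ ] t
    g≈t x j j≡u rewrite dec-true⁻¹ (j ≟ᶠ u) j≡u = constant x _

    trap : TrapSpace g ⁅ u ⁆ t
    trap x _ = g≈t x

    ⁅u⁆⊆R : ⁅ u ⁆ ⊆ R
    ⁅u⁆⊆R j j≡u rewrite dec-true⁻¹ (j ≟ᶠ u) j≡u = u∈R

    ∣R∣≡1+∣R′∣ : ∣ R ∣ ≡ suc ∣ R ∖ ⁅ u ⁆ ∣
    ∣R∣≡1+∣R′∣ = ∣S∣≡1+∣S∖⁅i⁆∣ R u∈R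

    result : Conclusion frozen (R ∖ ⁅ u ⁆) ∣ R ∖ ⁅ u ⁆ ∣
    result = IH (subst (_ <_) ∣R∣≡k (≤-reflexive (sym ∣R∣≡1+∣R′∣))) frozen (R ∖ ⁅ u ⁆) refl
                (frozen-confined trap confined ⁅u⁆⊆R) (frozen-noNegativeCycle noNegative)
    x = proj₁ (proj₁ result)
    fixed = proj₂ (proj₁ result)

    updated≈t : ∀ x → updComp g u x ≈[ ⁅ u ⁆ ] t
    updated≈t x j j≡u rewrite dec-true⁻¹ (j ≟ᶠ u) j≡u = trans (lookup∘update u x _) (constant x _)

    synchronizing : UniqueFixedPoint g → ∃ λ w → List.length w ≡ k × Synchronizes g R w
    synchronizing (x* , x*-fixed , unique) with proj₂ result frozen-unique
      where
      x*≈t : x* ≈[ ⁅ u ⁆ ] t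
      x*≈t j j≡u = trans (cong (λ y → lookup y j) (sym x*-fixed)) (g≈t x* j j≡u)
      frozen-unique : UniqueFixedPoint frozen
      frozen-unique = x* , fixed⇒frozen-fixed x*≈t x*-fixed ,
                      λ y y-fixed → unique y (frozen-fixed⇒fixed trap y-fixed)
    ... | w , length≡ , sync =
          u ∷ w , trans (cong suc length≡) (trans (sym ∣R∣≡1+∣R′∣) ∣R∣≡k) , sync′
      where
      sync′ : Synchronizes g R (u ∷ w)
      sync′ x y agree = trans (updWord-frozen trap w _ (updated≈t x))
                          (trans (sync _ _ agree′) (sym (updWord-frozen trap w _ (updated≈t y))))
        where
        agree′ : ∀ i → (R ∖ ⁅ u ⁆) i ≡ false → lookup (updComp g u x) i ≡ lookup (updComp g u y) i
        agree′ i i∉R′ with i ≟ᶠ u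
        ... | yes refl = trans (updated≈t x i (dec-true (i ≟ᶠ i) refl))
                               (sym (updated≈t y i (dec-true (i ≟ᶠ i) refl)))
        ... | no i≢u = trans (lookup∘update′ i≢u x _)
                        (trans (agree i (trans (sym (∧-identityʳ (R i))) i∉R′)) (sym (lookup∘update′ i≢u y _)))

  varying-case : ∀ {v₀} → R v₀ ≡ true → (∀ {u} → R u ≡ true → ¬ Constant (λ x → lookup (g x) u)) →
                 HasFixedPoint g × ¬ UniqueFixedPoint g
  varying-case v₀∈R varying = (proj₁ fixed₊ , proj₁ (proj₂ fixed₊)) , not-unique
    where
    R-closed : Ancestors.PredecessorClosed g R
    R-closed {u} w∈R (_ , arc) with R u in u∈R
    ... | true = refl
    ... | false = contradiction arc (proj₂ (confined u∈R))

    open Ancestors.InitialComponent (Ancestors.initial-component g R-closed v₀∈R)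

    labelling : ∃ (Balanced g T)
    labelling = balanced-labelling g noNegative T hub connected
    σ = proj₁ labelling
    σ⁻ = λ u → σ u · neg

    fixedPoint-labelled : ∀ {τ} → Balanced g T τ → ∃ λ x → IsFixedPoint g x × x ≈[ T ] signConfig τ
    fixedPoint-labelled {τ} balanced = fixedPoint-in-trap {t = signConfig τ}
      (balanced⇒trapSpace {g = g} {T} T-closed (varying ∘ T⊆R _) balanced) T⊆R hub∈T

    fixed₊ = fixedPoint-labelled (proj₂ labelling)
    fixed₋ = fixedPoint-labelled (balanced-negate (proj₂ labelling))

    not-unique : ¬ UniqueFixedPoint g
    not-unique (_ , _ , unique) = not-¬ refl (begin
      bit (σ hub)                ≡⟨ lookup∘tabulate (bit ∘ σ) hub ⟨
      lookup (signConfig σ) hub  ≡⟨ proj₂ (proj₂ fixed₊) hub hub∈T ⟨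
      lookup (proj₁ fixed₊) hub  ≡⟨ cong (λ x → lookup x hub) (trans (unique _ (proj₁ (proj₂ fixed₊)))
                                                                     (sym (unique _ (proj₁ (proj₂ fixed₋))))) ⟩
      lookup (proj₁ fixed₋) hub  ≡⟨ proj₂ (proj₂ fixed₋) hub hub∈T ⟩
      lookup (signConfig σ⁻) hub ≡⟨ lookup∘tabulate (bit ∘ σ⁻) hub ⟩
      bit (σ hub · neg)          ≡⟨ bit-·-neg (σ hub) ⟩
      not (bit (σ hub))          ∎)
      where open ≡-Reasoning

  conclusion : Conclusion g R k
  conclusion = by-cases (any? λ u → R u ≟ᵇ true)
                        (any? λ u → (R u ≟ᵇ true) ×-dec constant? (λ x → lookup (g x) u))
    where
    by-cases : Dec (∃ λ u → R u ≡ true) → Dec (∃ λ u → R u ≡ true × Constant (λ x → lookup (g x) u)) →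
               Conclusion g R k
    by-cases (no none) _ = empty-case λ i → ¬-not λ i∈R → none (i , i∈R)
    by-cases _ (yes (u , u∈R , const)) = constant-case u∈R const
    by-cases (yes (v₀ , v₀∈R)) (no none) =
      let hasFixedPoint , not-unique = varying-case v₀∈R (λ u∈R const → none (_ , u∈R , const))
      in hasFixedPoint , λ unique → contradiction unique not-unique

claim : ∀ {n} k → Claim n k
claim {n} = <-rec (Claim n) λ k IH g R ∣R∣≡k confined noNegative →
  InductionStep.conclusion IH g R ∣R∣≡k confined noNegative

proposition8 : (n : ℕ) (f : BN n) → NoNegativeCycle f →
    (UniqueFixedPoint f → ∃ λ w → List.length w ≡ n × IsSynchronizingWord f w)
    × ((∃ λ w → List.length w ≡ n × IsSynchronizingWord f w) → Synchronizing f)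
    × (Synchronizing f → UniqueFixedPoint f)
proposition8 n f noNegative = unique⇒word , (λ (w , _ , sync) → w , sync) , synchronizing⇒unique
  where
  conclusion : Conclusion f (λ _ → true) n
  conclusion = claim n f (λ _ → true) ∣full∣≡m (λ ()) noNegative

  unique⇒word : UniqueFixedPoint f → ∃ λ w → List.length w ≡ n × IsSynchronizingWord f w
  unique⇒word unique with proj₂ conclusion unique
  ... | w , length≡n , sync = w , length≡n , λ x y → sync x y λ _ ()

  synchronizing⇒unique : Synchronizing f → UniqueFixedPoint f
  synchronizing⇒unique (w , sync) with proj₁ conclusion
  ... | x , fixed = x , fixed , λ y y-fixed → synchronizing⇒fixedPoint-unique w sync y-fixed fixed
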